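{- Let $c$, $\prec$, $T'$ and $T^\beta$ be as in the context, and let $\beta\colon\mathbb{N}\to\mathbb{N}$ satisfy $\forall n,k\ \forall s\in\mathbb{B}^n\,(T'(s,k)\to T'(s,\beta n))$. Then for every $n$ there exists $s\in\mathbb{B}^n$ with $T^\beta(s)$, i.e. $\exists k'\in[n,\beta n]\ \forall i<n\,(s_i=0\leftrightarrow i\prec k')$.
   Context: $\mathbb{B}=\{0,1\}$; $c\colon\mathbb{N}^2\to\mathbb{B}$ with $c(i,j)=c(j,i)$. The Erdős–Rado order $\prec$: $0\prec1$, and, given $\prec$ already defined on $\{0,\dots,j\}$, for $j<i$ set $j\prec i$ iff $c(k,i)=c(k,j)$ for all $k\prec j$. For a finite binary sequence $s$ of length $|s|$ with entries $s_0,\dots,s_{|s|-1}$ and $k\in\mathbb{N}$: $T'(s,k):\equiv\exists k'\in[|s|,k]\ \forall i<|s|\,(s_i=0\leftrightarrow i\prec k')$; $T^\beta(s):\equiv T'(s,\beta(|s|))$. -}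

module Defs where

open import Data.Nat using (ℕ; zero; suc; _≤_; _<ᵇ_)
open import Data.Bool using (Bool; true; false; _∧_; _∨_; not)
open import Data.Bool.Properties using () renaming (_≟_ to _≟ᵇ_)
open import Relation.Nullary.Decidable using (⌊_⌋)
open import Data.Fin using (Fin; toℕ)
open import Data.Vec using (Vec; lookup)
open import Data.Product using (Σ; ∃; _×_; _,_)
open import Relation.Binary.PropositionalEquality using (_≡_)
open import Function.Bundles using (_⇔_)

-- A colouring c : ℕ² → 𝔹 (𝔹 = Bool, with 0 = false, 1 = true).
Colouring : Set
Colouring = ℕ → ℕ → Bool

Symmetric : Colouring → Set
Symmetric c = ∀ i j → c i j ≡ c j i

allBelow : ℕ → (ℕ → Bool) → Bool
allBelow zero    p = true
allBelow (suc j) p = allBelow j p ∧ p j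

-- Erdős–Rado order, computed by recursion on j with fuel (fuel = j + 1 suffices):
-- j ≺ i  iff  j < i  and  ∀ k < j, (k ≺ j → c(k,i) = c(k,j)).
precF : Colouring → ℕ → ℕ → ℕ → Bool
precF c zero    j i = false
precF c (suc f) j i =
  (j <ᵇ i) ∧ allBelow j (λ k → not (precF c f k j) ∨ ⌊ c k i ≟ᵇ c k j ⌋)

precᵇ : Colouring → ℕ → ℕ → Bool
precᵇ c j i = precF c (suc j) j i

_≺[_]_ : ℕ → Colouring → ℕ → Set
j ≺[ c ] i = precᵇ c j i ≡ true

T′ : Colouring → {n : ℕ} → Vec Bool n → ℕ → Set
T′ c {n} s k = Σ ℕ λ k′ → (n ≤ k′) × (k′ ≤ k) ×
  ((i : Fin n) → (lookup s i ≡ false) ⇔ (toℕ i ≺[ c ] k′))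

Tβ : Colouring → (ℕ → ℕ) → {n : ℕ} → Vec Bool n → Set
Tβ c β {n} s = T′ c s (β n)

-- The sequence recording which i < n satisfy i ≺ n witnesses T′(s, n) with k′ = n
-- itself; the hypothesis on β then lifts this to T′(s, β n).
module Submission where

open import Defs
open import Data.Nat using (ℕ)
open import Data.Nat.Properties using (≤-refl)
open import Data.Bool using (Bool; true; false; not)
open import Data.Vec using (Vec; tabulate)
open import Data.Vec.Properties using (lookup∘tabulate)
open import Data.Fin using (toℕ)
open import Data.Product using (Σ; _,_)
open import Function using (const)
open import Function.Bundles using (_⇔_; mk⇔)
open import Relation.Binary.PropositionalEquality using (_≡_; refl; sym; subst)

not≡false⇔≡true : ∀ {b} → (not b ≡ false) ⇔ (b ≡ true)
not≡false⇔≡true {false} = mk⇔ (λ ()) (λ ())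
not≡false⇔≡true {true}  = mk⇔ (const refl) (const refl)

≺-profile : Colouring → (k : ℕ) → Vec Bool k
≺-profile c k = tabulate λ i → not (precᵇ c (toℕ i) k)

T′-≺-profile : ∀ c k → T′ c (≺-profile c k) k
T′-≺-profile c k = k , ≤-refl , ≤-refl , λ i →
  subst (λ b → (b ≡ false) ⇔ (toℕ i ≺[ c ] k))
        (sym (lookup∘tabulate _ i))
        not≡false⇔≡true

lemma4p1 : (c : Colouring) → Symmetric c → (β : ℕ → ℕ) →
    ((n k : ℕ) (s : Vec Bool n) → T′ c s k → T′ c s (β n)) →
    (n : ℕ) → Σ (Vec Bool n) (λ s → Tβ c β s)
lemma4p1 c _ β lift n = ≺-profile c n , lift n n (≺-profile c n) (T′-≺-profile c n)
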